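{- Let $B$ be a bubble with colors $\{1,\dots,d\}$ containing two vertices $v,\bar v$ joined by $q>d/2$ parallel edges. Then every graph in $\mathcal{G}^{\max}_1(B)$ has an edge of color 0 between $v$ and $\bar v$; i.e. $\pi(v)=\bar v$ for every maximizing pairing $\pi$.
   Context: A bubble is a finite connected bipartite graph (black/white vertices, multiple edges allowed) with edges colored in $\{1,\dots,d\}$, each vertex having exactly one incident edge of each color. A pairing of $B$ is a perfect matching $\pi$ between its black and white vertices; adding an edge of color 0 between each $v$ and $\pi(v)$ yields a colored graph with colors $\{0,\dots,d\}$; the set of such graphs is $\mathcal{G}_1(B)$. A bicolored cycle with colors $\{a,b\}$ is a connected component of the subgraph of edges of colors $a,b$; $C_0(G)$ is the number of bicolored cycles with colors $\{0,c\}$, $c=1,\dots,d$; $\mathcal{G}^{\max}_1(B)$ is the set of graphs in $\mathcal{G}_1(B)$ maximizing $C_0$. -}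

module Defs where

open import Data.Nat using (ℕ; _+_; _≤_)
open import Data.Fin using (Fin; _≟_)
open import Data.Fin.Permutation using (Permutation′; _⟨$⟩ʳ_)
open import Data.Sum using (_⊎_; inj₁; inj₂)
open import Data.Product using (Σ; ∃; _×_; _,_)
open import Data.List using (length; filter; allFin)
open import Function.Bundles using (_⇔_)
open import Relation.Binary.PropositionalEquality using (_≡_)
open import Relation.Binary.Construct.Closure.ReflexiveTransitive using (Star)

-- A bubble with colours 1..d on n black and n white vertices is given by,
-- for each colour c : Fin d, a permutation σ c : black i -- white (σ c i).
-- (Each vertex has exactly one incident edge of each colour; multi-edges allowed.)
Colouring : ℕ → ℕ → Set
Colouring d n = Fin d → Permutation′ n

-- vertices: inj₁ i = black i, inj₂ j = white j
Vertex : ℕ → Set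
Vertex n = Fin n ⊎ Fin n

data MatchEdge {n : ℕ} (f : Fin n → Fin n) : Vertex n → Vertex n → Set where
  bw : ∀ i → MatchEdge f (inj₁ i) (inj₂ (f i))
  wb : ∀ i → MatchEdge f (inj₂ (f i)) (inj₁ i)

BubbleEdge : ∀ {d n} → Colouring d n → Vertex n → Vertex n → Set
BubbleEdge {d} σ x y = Σ (Fin d) λ c → MatchEdge (σ c ⟨$⟩ʳ_) x y

IsConnectedBubble : ∀ {d n} → Colouring d n → Set
IsConnectedBubble {n = n} σ = ∀ (x y : Vertex n) → Star (BubbleEdge σ) x y

multiplicity : ∀ {d n} → Colouring d n → Fin n → Fin n → ℕ
multiplicity {d} σ i j = length (filter (λ c → σ c ⟨$⟩ʳ i ≟ j) (allFin d))

-- edges of the bicoloured subgraph with colours {0,c}, where colour 0 is the pairing π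
BicolEdge : ∀ {d n} → Colouring d n → Permutation′ n → Fin d → Vertex n → Vertex n → Set
BicolEdge σ π c x y = MatchEdge (π ⟨$⟩ʳ_) x y ⊎ MatchEdge (σ c ⟨$⟩ʳ_) x y

-- "the graph with edge relation E on vertex set V has exactly k connected components":
-- a surjective labelling of vertices by Fin k whose fibres are exactly the components.
HasComponents : {V : Set} → (V → V → Set) → ℕ → Set
HasComponents {V} E k =
  Σ (V → Fin k) λ f →
    (∀ (a : Fin k) → ∃ λ x → f x ≡ a) ×
    (∀ (x y : V) → (f x ≡ f y) ⇔ Star E x y)

sumFin : ∀ {d} → (Fin d → ℕ) → ℕ
sumFin {ℕ.zero} g = 0
sumFin {ℕ.suc d} g = g Fin.zero + sumFin (λ c → g (Fin.suc c))

-- C₀(G) = m : total number of bicoloured cycles with colours {0,c}, c = 1..d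
C₀ : ∀ {d n} → Colouring d n → Permutation′ n → ℕ → Set
C₀ {d} σ π m =
  Σ (Fin d → ℕ) λ ks →
    (∀ c → HasComponents (BicolEdge σ π c) (ks c)) × (sumFin ks ≡ m)

IsMaxPairing : ∀ {d n} → Colouring d n → Permutation′ n → Set
IsMaxPairing {n = n} σ π =
  Σ ℕ λ m → C₀ σ π m × (∀ (π' : Permutation′ n) (m' : ℕ) → C₀ σ π' m' → m' ≤ m)

module Submission where

-- Suppose the maximising pairing π
-- does not pair v with v̄, and let u be the vertex that π pairs with v̄.  The
-- pairing π′ obtained by exchanging the partners of v and u changes, for every
-- colour c, the bicoloured graph {0,c} only by replacing the two 0-edges
-- v–π(v), u–v̄ by v–v̄, u–π(v).  Such a local surgery destroys at most one
-- bicoloured cycle; and when σ_c(v) = v̄ it creates one, because v, v̄ then form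
-- a cycle of length two under π′ while v and u lay on a common cycle under π.
-- Summing over colours, C₀(π′) ≥ C₀(π) + 2·mult(v,v̄) − d > C₀(π), contradicting
-- maximality.

open import Defs
open import Data.Nat using (ℕ; zero; suc; _+_; _*_; _≤_; _<_; z≤n; s≤s)
open import Data.Nat.Properties
  using (n≤1+n; n<1+n; ≤-refl; <⇒≤; <⇒≱; +-comm; +-identityʳ; +-mono-≤; +-monoˡ-≤; +-cancelˡ-≤;
         ≤-trans; m≤n⇒m<n∨m≡n; m≤n⇒∃[o]m+o≡n; +-commutativeSemigroup)
open import Algebra.Properties.CommutativeSemigroup +-commutativeSemigroup using (interchange)
open import Data.Fin using (Fin; _≟_; toℕ; fromℕ<; punchOut; punchIn)
  renaming (zero to fzero; suc to fsuc)
open import Data.Fin.Properties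
  using (pigeonhole; any?; toℕ-fromℕ<; suc-injective;
         punchOut-cong; punchOut-injective; punchOut-punchIn; punchInᵢ≢i)
open import Data.Fin.Permutation using (Permutation′; _⟨$⟩ʳ_; _⟨$⟩ˡ_; inverseˡ; inverseʳ; transpose; _∘ₚ_)
import Data.Fin.Permutation.Components as Components
open import Data.List using (length; filter; tabulate)
open import Data.Sum using (_⊎_; inj₁; inj₂)
open import Data.Sum.Properties using (inj₁-injective; inj₂-injective)
open import Data.Product using (Σ; ∃; _×_; _,_; proj₁; proj₂)
open import Data.Empty using (⊥-elim)
open import Function using (_∘_; id)
open import Function.Bundles using (_⇔_; mk⇔; Equivalence)
open import Relation.Nullary using (¬_; Dec; yes; no)
open import Relation.Nullary.Decidable using (_⊎-dec_)
open import Relation.Binary.Definitions using (Symmetric)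
open import Relation.Binary.PropositionalEquality using (_≡_; refl; sym; trans; cong; subst; subst₂)
open import Relation.Binary.Construct.Closure.ReflexiveTransitive using (Star; ε; _◅_; _◅◅_; fold; reverse)

pattern black i = inj₁ i
pattern white j = inj₂ j

constant-on-paths : ∀ {V A : Set} {R : V → V → Set} (g : V → A) →
  (∀ {x y} → R x y → g x ≡ g y) → ∀ {x y} → Star R x y → g x ≡ g y
constant-on-paths g along = fold (λ x y → g x ≡ g y) (λ e eq → trans (along e) eq) refl

perm-injective : ∀ {n} (π : Permutation′ n) {i j} → π ⟨$⟩ʳ i ≡ π ⟨$⟩ʳ j → i ≡ j
perm-injective π {i} {j} eq = trans (sym (inverseˡ π)) (trans (cong (π ⟨$⟩ˡ_) eq) (inverseˡ π))

perm⁻¹-injective : ∀ {n} (π : Permutation′ n) {i j} → π ⟨$⟩ˡ i ≡ π ⟨$⟩ˡ j → i ≡ j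
perm⁻¹-injective π {i} {j} eq = trans (sym (inverseʳ π)) (trans (cong (π ⟨$⟩ʳ_) eq) (inverseʳ π))

transpose-left : ∀ {n} (i j : Fin n) → Components.transpose i j i ≡ j
transpose-left i j with i ≟ i
... | yes _ = refl
... | no i≢i = ⊥-elim (i≢i refl)

transpose-right : ∀ {n} (i j : Fin n) → Components.transpose i j j ≡ i
transpose-right i j with j ≟ i
... | yes j≡i = j≡i
... | no _ with j ≟ j
...   | yes _ = refl
...   | no j≢j = ⊥-elim (j≢j refl)

transpose-other : ∀ {n} (i j k : Fin n) → ¬ k ≡ i → ¬ k ≡ j → Components.transpose i j k ≡ k
transpose-other i j k k≢i k≢j with k ≟ i
... | yes k≡i = ⊥-elim (k≢i k≡i)
... | no _ with k ≟ j
...   | yes k≡j = ⊥-elim (k≢j k≡j)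
...   | no _ = refl

merge : ∀ {k} (l₁ l₂ : Fin k) → ¬ l₁ ≡ l₂ →
  Σ ℕ λ k' → k ≡ suc k' ×
    Σ (Fin k → Fin k') λ r →
      (∀ t → ∃ λ l → r l ≡ t) ×
      (∀ l l' → r l ≡ r l' → l ≡ l' ⊎ ((l ≡ l₁ ⊎ l ≡ l₂) × (l' ≡ l₁ ⊎ l' ≡ l₂))) ×
      r l₁ ≡ r l₂
merge {suc K} l₁ l₂ l₁≢l₂ = K , refl , r , onto , fibres , merged
  where
  l₂≢l₁ : ¬ l₂ ≡ l₁
  l₂≢l₁ = l₁≢l₂ ∘ sym

  -- l₂ is sent where l₁ goes; every other label is punched out around l₂
  r′ : ∀ l → Dec (l ≡ l₂) → Fin K
  r′ l (yes _) = punchOut l₂≢l₁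
  r′ l (no l≢l₂) = punchOut (l≢l₂ ∘ sym)

  r : Fin (suc K) → Fin K
  r l = r′ l (l ≟ l₂)

  onto : ∀ t → ∃ λ l → r l ≡ t
  onto t = punchIn l₂ t , hit (punchIn l₂ t ≟ l₂)
    where
    hit : (d : Dec (punchIn l₂ t ≡ l₂)) → r′ (punchIn l₂ t) d ≡ t
    hit (yes eq) = ⊥-elim (punchInᵢ≢i l₂ t eq)
    hit (no _) = trans (punchOut-cong l₂ refl) (punchOut-punchIn l₂)

  fibres : ∀ l l' → r l ≡ r l' → l ≡ l' ⊎ ((l ≡ l₁ ⊎ l ≡ l₂) × (l' ≡ l₁ ⊎ l' ≡ l₂))
  fibres l l' eq with l ≟ l₂ | l' ≟ l₂
  ... | yes l≡ | yes l'≡ = inj₁ (trans l≡ (sym l'≡))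
  ... | yes l≡ | no _ = inj₂ (inj₂ l≡ , inj₁ (sym (punchOut-injective l₂≢l₁ _ eq)))
  ... | no _ | yes l'≡ = inj₂ (inj₁ (punchOut-injective _ l₂≢l₁ eq) , inj₂ l'≡)
  ... | no l≢ | no l′≢ = inj₁ (punchOut-injective {i = l₂} (l≢ ∘ sym) (l′≢ ∘ sym) eq)

  merged : r l₁ ≡ r l₂
  merged with l₁ ≟ l₂ | l₂ ≟ l₂
  ... | yes eq | _ = ⊥-elim (l₁≢l₂ eq)
  ... | no _ | yes _ = punchOut-cong l₂ refl
  ... | no _ | no l₂≢l₂ = ⊥-elim (l₂≢l₂ refl)

-- E and E′ are graphs on the same vertices that differ only
-- at hub vertices: an edge of one graph is an edge of the other unless it touches
-- a hub, and (in both graphs) every hub is connected to one of two anchors a, b.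
-- Given a component labelling f of E, the components of E′ are those of E except
-- that the ("touched") components of E through a and b are replaced by the
-- components of E′ through a and b.  Hence E′ loses at most one component, and
-- gains one when a, b are connected in E but not in E′.
module Surgery {V : Set} {E E′ : V → V → Set} (E′-sym : Symmetric E′)
    (Hub : V → Set) (a b : V)
    (old-edge : ∀ {x y} → E x y → E′ x y ⊎ Hub x)
    (new-edge : ∀ {x y} → E′ x y → E x y ⊎ (Hub x × Hub y))
    (hub-old : ∀ {h} → Hub h → Star E h a ⊎ Star E h b)
    (hub-new : ∀ {h} → Hub h → Star E′ h a ⊎ Star E′ h b)
    {k : ℕ} (f : V → Fin k) (f-onto : ∀ l → ∃ λ x → f x ≡ l)
    (f-components : ∀ x y → (f x ≡ f y) ⇔ Star E x y) where

  joined : ∀ {x y} → f x ≡ f y → Star E x y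
  joined {x} {y} = Equivalence.to (f-components x y)

  same-label : ∀ {x y} → Star E x y → f x ≡ f y
  same-label {x} {y} = Equivalence.from (f-components x y)

  Touched : Fin k → Set
  Touched l = l ≡ f a ⊎ l ≡ f b

  touched? : ∀ l → Dec (Touched l)
  touched? l = (l ≟ f a) ⊎-dec (l ≟ f b)

  hub-touched : ∀ {h} → Hub h → Touched (f h)
  hub-touched hub with hub-old hub
  ... | inj₁ path = inj₁ (same-label path)
  ... | inj₂ path = inj₂ (same-label path)

  old-path : ∀ {x y} → Star E x y → Star E′ x y ⊎ ∃ λ h → Hub h × Star E′ x h
  old-path ε = inj₁ ε
  old-path (e ◅ es) with old-edge e
  ... | inj₂ hub = inj₂ (_ , hub , ε)
  ... | inj₁ e′ with old-path es
  ...   | inj₁ path = inj₁ (e′ ◅ path)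
  ...   | inj₂ (h , hub , path) = inj₂ (h , hub , e′ ◅ path)

  new-path : ∀ {x y} → Star E′ x y → f x ≡ f y ⊎ Touched (f x)
  new-path ε = inj₁ refl
  new-path (e ◅ es) with new-edge e
  ... | inj₂ (hub , _) = inj₂ (hub-touched hub)
  ... | inj₁ e₀ with new-path es
  ...   | inj₁ eq = inj₁ (trans (same-label (e₀ ◅ ε)) eq)
  ...   | inj₂ t = inj₂ (subst Touched (sym (same-label (e₀ ◅ ε))) t)

  touched-source : ∀ {x y} → Star E′ x y → Touched (f y) → Touched (f x)
  touched-source path t with new-path path
  ... | inj₁ eq = subst Touched (sym eq) t
  ... | inj₂ t′ = t′

  untouched-path : ∀ {x y} → Star E′ x y → ¬ Touched (f x) → f x ≡ f y
  untouched-path path ¬t with new-path path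
  ... | inj₁ eq = eq
  ... | inj₂ t = ⊥-elim (¬t t)

  untouched-joined : ∀ {x y} → ¬ Touched (f x) → f x ≡ f y → Star E′ x y
  untouched-joined ¬t eq with old-path (joined eq)
  ... | inj₁ path = path
  ... | inj₂ (_ , hub , path) = ⊥-elim (¬t (touched-source path (hub-touched hub)))

  Anchored : V → Set
  Anchored x = Star E′ x a ⊎ Star E′ x b

  anchored-before : ∀ {x y} → Star E′ x y → Anchored y → Anchored x
  anchored-before path (inj₁ to-a) = inj₁ (path ◅◅ to-a)
  anchored-before path (inj₂ to-b) = inj₂ (path ◅◅ to-b)

  anchored-old : ∀ {x z} → Star E x z → Anchored z → Anchored x
  anchored-old path anchored-z with old-path path
  ... | inj₁ path′ = anchored-before path′ anchored-z
  ... | inj₂ (_ , hub , path′) = anchored-before path′ (hub-new hub)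

  anchored : ∀ {x} → Touched (f x) → Anchored x
  anchored (inj₁ eq) = anchored-old (joined eq) (inj₁ ε)
  anchored (inj₂ eq) = anchored-old (joined eq) (inj₂ ε)

  module Joined (a~b : Star E′ a b) {k′ : ℕ} (r : Fin k → Fin k′)
      (r-onto : ∀ t → ∃ λ l → r l ≡ t)
      (r-fibres : ∀ l l′ → r l ≡ r l′ → l ≡ l′ ⊎ (Touched l × Touched l′))
      (r-merges : r (f a) ≡ r (f b)) where

    to-a : ∀ {x} → Touched (f x) → Star E′ x a
    to-a t with anchored t
    ... | inj₁ path = path
    ... | inj₂ path = path ◅◅ reverse E′-sym a~b

    r-touched : ∀ {l} → Touched l → r l ≡ r (f a)
    r-touched (inj₁ refl) = refl
    r-touched (inj₂ refl) = sym r-merges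

    label-along : ∀ {x y} → E′ x y → r (f x) ≡ r (f y)
    label-along e with new-edge e
    ... | inj₁ e₀ = cong r (same-label (e₀ ◅ ε))
    ... | inj₂ (hx , hy) = trans (r-touched (hub-touched hx)) (sym (r-touched (hub-touched hy)))

    label-joins : ∀ x y → r (f x) ≡ r (f y) → Star E′ x y
    label-joins x y eq with r-fibres _ _ eq
    ... | inj₂ (tx , ty) = to-a tx ◅◅ reverse E′-sym (to-a ty)
    ... | inj₁ same with touched? (f x)
    ...   | yes tx = to-a tx ◅◅ reverse E′-sym (to-a (subst Touched same tx))
    ...   | no ¬tx = untouched-joined ¬tx same

    components : HasComponents E′ k′
    components = r ∘ f , onto , λ x y → mk⇔ (label-joins x y) (constant-on-paths (r ∘ f) label-along)
      where
      onto : ∀ t → ∃ λ x → r (f x) ≡ t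
      onto t with r-onto t
      ... | l , rl≡t with f-onto l
      ...   | x , refl = x , rl≡t

  module Separated (a≁b : ¬ Star E′ a b) {k′ : ℕ} (e : Fin k → Fin k′) (A B : Fin k′)
      (A≢B : ¬ A ≡ B)
      (e-avoids : ∀ l → ¬ Touched l → ¬ e l ≡ A × ¬ e l ≡ B)
      (e-injective : ∀ l l′ → e l ≡ e l′ → l ≡ l′)
      (e-covers : ∀ t → t ≡ A ⊎ t ≡ B ⊎ ∃ λ l → ¬ Touched l × e l ≡ t) where

    side : ∀ {x} → Anchored x → Fin k′
    side (inj₁ _) = A
    side (inj₂ _) = B

    label′ : ∀ x → Dec (Touched (f x)) → Fin k′
    label′ x (yes t) = side (anchored t)
    label′ x (no _) = e (f x)

    label : V → Fin k′
    label x = label′ x (touched? (f x))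

    label-a : ∀ x → Star E′ x a → label x ≡ A
    label-a x to-a with touched? (f x)
    ... | no ¬t = ⊥-elim (¬t (touched-source to-a (inj₁ refl)))
    ... | yes t with anchored t
    ...   | inj₁ _ = refl
    ...   | inj₂ to-b = ⊥-elim (a≁b (reverse E′-sym to-a ◅◅ to-b))

    label-b : ∀ x → Star E′ x b → label x ≡ B
    label-b x to-b with touched? (f x)
    ... | no ¬t = ⊥-elim (¬t (touched-source to-b (inj₂ refl)))
    ... | yes t with anchored t
    ...   | inj₂ _ = refl
    ...   | inj₁ to-a = ⊥-elim (a≁b (reverse E′-sym to-a ◅◅ to-b))

    label-untouched : ∀ x → ¬ Touched (f x) → label x ≡ e (f x)
    label-untouched x ¬t with touched? (f x)
    ... | yes t = ⊥-elim (¬t t)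
    ... | no _ = refl

    label-touched : ∀ x → Touched (f x) → label x ≡ A ⊎ label x ≡ B
    label-touched x t with anchored t
    ... | inj₁ to-a = inj₁ (label-a x to-a)
    ... | inj₂ to-b = inj₂ (label-b x to-b)

    label-along : ∀ {x y} → E′ x y → label x ≡ label y
    label-along {x} {y} edge = along (touched? (f x))
      where
      along : Dec (Touched (f x)) → label x ≡ label y
      along (yes t) with anchored t
      ... | inj₁ to-a = trans (label-a x to-a) (sym (label-a y (E′-sym edge ◅ to-a)))
      ... | inj₂ to-b = trans (label-b x to-b) (sym (label-b y (E′-sym edge ◅ to-b)))
      along (no ¬t) =
        let eq = untouched-path (edge ◅ ε) ¬t in
        trans (label-untouched x ¬t)
              (trans (cong e eq) (sym (label-untouched y (¬t ∘ subst Touched (sym eq)))))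

    mixed-apart : ∀ x y → Touched (f x) → ¬ Touched (f y) → ¬ label x ≡ label y
    mixed-apart x y tx ¬ty eq with label-touched x tx
    ... | inj₁ x-A = proj₁ (e-avoids (f y) ¬ty) (trans (sym (label-untouched y ¬ty)) (trans (sym eq) x-A))
    ... | inj₂ x-B = proj₂ (e-avoids (f y) ¬ty) (trans (sym (label-untouched y ¬ty)) (trans (sym eq) x-B))

    label-joins : ∀ x y → label x ≡ label y → Star E′ x y
    label-joins x y eq = joins (touched? (f x)) (touched? (f y))
      where
      joins : Dec (Touched (f x)) → Dec (Touched (f y)) → Star E′ x y
      joins (yes tx) (yes ty) with anchored tx | anchored ty
      ... | inj₁ x-a | inj₁ y-a = x-a ◅◅ reverse E′-sym y-a
      ... | inj₂ x-b | inj₂ y-b = x-b ◅◅ reverse E′-sym y-b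
      ... | inj₁ x-a | inj₂ y-b = ⊥-elim (A≢B (trans (sym (label-a x x-a)) (trans eq (label-b y y-b))))
      ... | inj₂ x-b | inj₁ y-a = ⊥-elim (A≢B (trans (sym (label-a y y-a)) (trans (sym eq) (label-b x x-b))))
      joins (yes tx) (no ¬ty) = ⊥-elim (mixed-apart x y tx ¬ty eq)
      joins (no ¬tx) (yes ty) = ⊥-elim (mixed-apart y x ty ¬tx (sym eq))
      joins (no ¬tx) (no ¬ty) =
        untouched-joined ¬tx
          (e-injective _ _ (trans (sym (label-untouched x ¬tx)) (trans eq (label-untouched y ¬ty))))

    components : HasComponents E′ k′
    components = label , onto , λ x y → mk⇔ (label-joins x y) (constant-on-paths label label-along)
      where
      onto : ∀ t → ∃ λ x → label x ≡ t
      onto t with e-covers t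
      ... | inj₁ refl = a , label-a a ε
      ... | inj₂ (inj₁ refl) = b , label-b b ε
      ... | inj₂ (inj₂ (l , ¬t , refl)) with f-onto l
      ...   | x , refl = x , label-untouched x ¬t

  surgery : Dec (Star E′ a b) →
    Σ ℕ λ k′ → HasComponents E′ k′ × k ≤ suc k′ × (f a ≡ f b → ¬ Star E′ a b → suc k ≤ k′)
  surgery (yes a~b) with f a ≟ f b
  ... | yes same =
    k , Joined.components a~b id (λ t → t , refl) (λ _ _ eq → inj₁ eq) same ,
    n≤1+n k , λ _ a≁b → ⊥-elim (a≁b a~b)
  ... | no differ with merge (f a) (f b) differ
  ...   | k′ , k≡ , r , r-onto , r-fibres , r-merges =
    k′ , Joined.components a~b r r-onto r-fibres r-merges ,
    subst (_≤ suc k′) (sym k≡) ≤-refl , λ _ a≁b → ⊥-elim (a≁b a~b)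
  surgery (no a≁b) with f a ≟ f b
  ... | yes same =
    suc k , Separated.components a≁b fsuc (fsuc (f a)) fzero (λ ()) avoids (λ _ _ → suc-injective) covers ,
    ≤-trans (n≤1+n k) (n≤1+n (suc k)) , λ _ _ → ≤-refl
    where
    avoids : ∀ l → ¬ Touched l → ¬ fsuc l ≡ fsuc (f a) × ¬ fsuc l ≡ fzero
    avoids l ¬t = (λ eq → ¬t (inj₁ (suc-injective eq))) , λ ()
    covers : ∀ t → t ≡ fsuc (f a) ⊎ t ≡ fzero ⊎ ∃ λ l → ¬ Touched l × fsuc l ≡ t
    covers fzero = inj₂ (inj₁ refl)
    covers (fsuc l) with l ≟ f a
    ... | yes refl = inj₁ refl
    ... | no l≢a = inj₂ (inj₂ (l , (λ { (inj₁ eq) → l≢a eq ; (inj₂ eq) → l≢a (trans eq (sym same)) }) , refl))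
  ... | no differ =
    k , Separated.components a≁b id (f a) (f b) differ avoids (λ _ _ eq → eq) covers ,
    n≤1+n k , λ same → ⊥-elim (differ same)
    where
    avoids : ∀ l → ¬ Touched l → ¬ l ≡ f a × ¬ l ≡ f b
    avoids l ¬t = ¬t ∘ inj₁ , ¬t ∘ inj₂
    covers : ∀ t → t ≡ f a ⊎ t ≡ f b ⊎ ∃ λ l → ¬ Touched l × l ≡ t
    covers t with t ≟ f a | t ≟ f b
    ... | yes t≡a | _ = inj₁ t≡a
    ... | no _ | yes t≡b = inj₂ (inj₁ t≡b)
    ... | no t≢a | no t≢b = inj₂ (inj₂ (t , (λ { (inj₁ eq) → t≢a eq ; (inj₂ eq) → t≢b eq }) , refl))

Union : ∀ {n} → Permutation′ n → Permutation′ n → Vertex n → Vertex n → Set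
Union P S x y = MatchEdge (P ⟨$⟩ʳ_) x y ⊎ MatchEdge (S ⟨$⟩ʳ_) x y

MatchEdge-sym : ∀ {n} {f : Fin n → Fin n} {x y} → MatchEdge f x y → MatchEdge f y x
MatchEdge-sym (bw i) = wb i
MatchEdge-sym (wb i) = bw i

Union-sym : ∀ {n} (P S : Permutation′ n) → Symmetric (Union P S)
Union-sym P S (inj₁ e) = inj₁ (MatchEdge-sym e)
Union-sym P S (inj₂ e) = inj₂ (MatchEdge-sym e)

-- Connectivity in the union of two perfect matchings is decidable: the black
-- vertices of a component form an orbit of ρ = S⁻¹ ∘ P, which is searched for
-- up to its (finite) period.
module Alternating {n : ℕ} (P S : Permutation′ n) where

  E : Vertex n → Vertex n → Set
  E = Union P S

  -- one round of an alternating cycle: a P-edge, then an S-edge back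
  ρ : Fin n → Fin n
  ρ x = S ⟨$⟩ˡ (P ⟨$⟩ʳ x)

  ρ-injective : ∀ {x y} → ρ x ≡ ρ y → x ≡ y
  ρ-injective = perm-injective P ∘ perm⁻¹-injective S

  orbit : ℕ → Fin n → Fin n
  orbit zero x = x
  orbit (suc j) x = ρ (orbit j x)

  round : ∀ x → Star E (black x) (black (ρ x))
  round x = inj₁ (bw x) ◅ subst (λ w → E (white w) (black (ρ x))) (inverseʳ S) (inj₂ (wb (ρ x))) ◅ ε

  walk : ∀ j x → Star E (black x) (black (orbit j x))
  walk zero x = ε
  walk (suc j) x = walk j x ◅◅ round (orbit j x)

  -- ρ is injective, so a repetition in the orbit closes a cycle through x
  cancel : ∀ i q x → orbit i x ≡ orbit (suc (i + q)) x → orbit (suc q) x ≡ x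
  cancel zero q x eq = sym eq
  cancel (suc i) q x eq = cancel i q x (ρ-injective eq)

  period : ∀ x → ∃ λ q → orbit (suc q) x ≡ x
  period x with pigeonhole (n<1+n n) (λ (t : Fin (suc n)) → orbit (toℕ t) x)
  ... | i , j , i<j , eq with m≤n⇒∃[o]m+o≡n i<j
  ...   | q , i+q≡j = q , cancel (toℕ i) q x (trans eq (cong (λ m → orbit m x) (sym i+q≡j)))

  module Cycle (x : Fin n) (q : ℕ) (closes : orbit (suc q) x ≡ x) where

    OnCycle : Fin n → Set
    OnCycle y = Σ ℕ λ j → j ≤ q × orbit j x ≡ y

    forward : ∀ {y z} → ρ y ≡ z → OnCycle y → OnCycle z
    forward {y} {z} ρy≡z (j , j≤q , hit) with m≤n⇒m<n∨m≡n j≤q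
    ... | inj₁ j<q = suc j , j<q , trans (cong ρ hit) ρy≡z
    ... | inj₂ refl = zero , z≤n , trans (sym closes) (trans (cong ρ hit) ρy≡z)

    backward : ∀ {y z} → ρ z ≡ y → OnCycle y → OnCycle z
    backward ρz≡y (zero , _ , hit) = q , ≤-refl , ρ-injective (trans closes (trans hit (sym ρz≡y)))
    backward ρz≡y (suc j , j<q , hit) = j , <⇒≤ j<q , ρ-injective (trans hit (sym ρz≡y))

    base : Vertex n → Fin n
    base (black x) = x
    base (white w) = P ⟨$⟩ˡ w

    ρ-base : ∀ i → ρ (P ⟨$⟩ˡ (S ⟨$⟩ʳ i)) ≡ i
    ρ-base i = trans (cong (S ⟨$⟩ˡ_) (inverseʳ P)) (inverseˡ S)

    along : ∀ {y z} → Star E y z → OnCycle (base y) → OnCycle (base z)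
    along ε on = on
    along (inj₁ (bw i) ◅ es) (j , j≤q , hit) = along es (j , j≤q , trans hit (sym (inverseˡ P)))
    along (inj₁ (wb i) ◅ es) (j , j≤q , hit) = along es (j , j≤q , trans hit (inverseˡ P))
    along (inj₂ (bw i) ◅ es) on = along es (backward (ρ-base i) on)
    along (inj₂ (wb i) ◅ es) on = along es (forward (ρ-base i) on)

  reachable? : (x y : Fin n) → Dec (Star E (black x) (black y))
  reachable? x y with period x
  ... | q , closes with any? (λ (t : Fin (suc q)) → orbit (toℕ t) x ≟ y)
  ... | yes (t , hit) = yes (subst (λ w → Star E (black x) (black w)) hit (walk (toℕ t) x))
  ... | no miss = no λ path →
    let (j , j≤q , hit) = Cycle.along x q closes path (zero , z≤n , refl)
    in miss (fromℕ< (s≤s j≤q) , trans (cong (λ m → orbit m x) (toℕ-fromℕ< (s≤s j≤q))) hit)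

-- For every second matching S, the union with S changes by a
-- surgery with hubs v, P(v), u, v̄ and anchors v, u.
module Switch {n : ℕ} (P : Permutation′ n) (v v̄ : Fin n) (unpaired : ¬ P ⟨$⟩ʳ v ≡ v̄) where

  u : Fin n
  u = P ⟨$⟩ˡ v̄

  P′ : Permutation′ n
  P′ = transpose v u ∘ₚ P

  p p′ : Fin n → Fin n
  p = P ⟨$⟩ʳ_
  p′ = P′ ⟨$⟩ʳ_

  p-u : p u ≡ v̄
  p-u = inverseʳ P

  p′-v : p′ v ≡ v̄
  p′-v = trans (cong p (transpose-left v u)) p-u

  p′-u : p′ u ≡ p v
  p′-u = cong p (transpose-right v u)

  u≢v : ¬ u ≡ v
  u≢v u≡v = unpaired (trans (cong p (sym u≡v)) p-u)

  agree : ∀ i → p′ i ≡ p i ⊎ (i ≡ v ⊎ i ≡ u)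
  agree i = decide (i ≟ v) (i ≟ u)
    where
    decide : Dec (i ≡ v) → Dec (i ≡ u) → p′ i ≡ p i ⊎ (i ≡ v ⊎ i ≡ u)
    decide (yes i≡v) _ = inj₂ (inj₁ i≡v)
    decide (no _) (yes i≡u) = inj₂ (inj₂ i≡u)
    decide (no i≢v) (no i≢u) = inj₁ (cong p (transpose-other v u i i≢v i≢u))

  data Hub : Vertex n → Set where
    hub-v : Hub (black v)
    hub-pv : Hub (white (p v))
    hub-u : Hub (black u)
    hub-v̄ : Hub (white v̄)

  white-hub : ∀ {w w′} → w ≡ w′ → Hub (white w′) → Hub (white w)
  white-hub refl hub = hub

  module _ (S : Permutation′ n) where

    E E′ : Vertex n → Vertex n → Set
    E = Union P S
    E′ = Union P′ S

    old-edge : ∀ {x y} → E x y → E′ x y ⊎ Hub x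
    old-edge (inj₂ e) = inj₁ (inj₂ e)
    old-edge (inj₁ (bw i)) with agree i
    ... | inj₁ same = inj₁ (inj₁ (subst (λ w → MatchEdge p′ (black i) (white w)) same (bw i)))
    ... | inj₂ (inj₁ refl) = inj₂ hub-v
    ... | inj₂ (inj₂ refl) = inj₂ hub-u
    old-edge (inj₁ (wb i)) with agree i
    ... | inj₁ same = inj₁ (inj₁ (subst (λ w → MatchEdge p′ (white w) (black i)) same (wb i)))
    ... | inj₂ (inj₁ refl) = inj₂ hub-pv
    ... | inj₂ (inj₂ refl) = inj₂ (white-hub p-u hub-v̄)

    new-bw : ∀ i → E (black i) (white (p′ i)) ⊎ (Hub (black i) × Hub (white (p′ i)))
    new-bw i with agree i
    ... | inj₁ same = inj₁ (inj₁ (subst (λ w → MatchEdge p (black i) (white w)) (sym same) (bw i)))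
    ... | inj₂ (inj₁ refl) = inj₂ (hub-v , white-hub p′-v hub-v̄)
    ... | inj₂ (inj₂ refl) = inj₂ (hub-u , white-hub p′-u hub-pv)

    new-edge : ∀ {x y} → E′ x y → E x y ⊎ (Hub x × Hub y)
    new-edge (inj₂ e) = inj₁ (inj₂ e)
    new-edge (inj₁ (bw i)) = new-bw i
    new-edge (inj₁ (wb i)) with new-bw i
    ... | inj₁ e = inj₁ (Union-sym P S e)
    ... | inj₂ (hx , hy) = inj₂ (hy , hx)

    hub-old : ∀ {h} → Hub h → Star E h (black v) ⊎ Star E h (black u)
    hub-old hub-v = inj₁ ε
    hub-old hub-pv = inj₁ (inj₁ (wb v) ◅ ε)
    hub-old hub-u = inj₂ ε
    hub-old hub-v̄ = inj₂ (subst (λ w → E (white w) (black u)) p-u (inj₁ (wb u)) ◅ ε)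

    hub-new : ∀ {h} → Hub h → Star E′ h (black v) ⊎ Star E′ h (black u)
    hub-new hub-v = inj₁ ε
    hub-new hub-pv = inj₂ (subst (λ w → E′ (white w) (black u)) p′-u (inj₁ (wb u)) ◅ ε)
    hub-new hub-u = inj₂ ε
    hub-new hub-v̄ = inj₁ (subst (λ w → E′ (white w) (black v)) p′-v (inj₁ (wb v)) ◅ ε)

    -- If S pairs v with v̄ too, then v and u lie on one old cycle ...
    old-joined : S ⟨$⟩ʳ v ≡ v̄ → Star E (black v) (black u)
    old-joined paired =
      inj₂ (bw v) ◅ subst (λ w → E (white w) (black u)) (trans p-u (sym paired)) (inj₁ (wb u)) ◅ ε

    -- ... while {v, v̄} is a whole new cycle, which does not contain u.
    new-separated : S ⟨$⟩ʳ v ≡ v̄ → ¬ Star E′ (black v) (black u)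
    new-separated paired path with closed path (inj₁ refl)
      where
      InPair : Vertex n → Set
      InPair x = x ≡ black v ⊎ x ≡ white v̄

      closed-edge : ∀ {x y} → E′ x y → InPair x → InPair y
      closed-edge (inj₁ (bw i)) (inj₁ refl) = inj₂ (cong white p′-v)
      closed-edge (inj₁ (wb i)) (inj₂ eq) = inj₁ (cong black (perm-injective P′ (trans (inj₂-injective eq) (sym p′-v))))
      closed-edge (inj₂ (bw i)) (inj₁ refl) = inj₂ (cong white paired)
      closed-edge (inj₂ (wb i)) (inj₂ eq) = inj₁ (cong black (perm-injective S (trans (inj₂-injective eq) (sym paired))))
      closed-edge (inj₁ (bw i)) (inj₂ ())
      closed-edge (inj₁ (wb i)) (inj₁ ())
      closed-edge (inj₂ (bw i)) (inj₂ ())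
      closed-edge (inj₂ (wb i)) (inj₁ ())

      closed : ∀ {x y} → Star E′ x y → InPair x → InPair y
      closed ε inside = inside
      closed (e ◅ es) inside = closed es (closed-edge e inside)
    ... | inj₁ eq = u≢v (inj₁-injective eq)
    ... | inj₂ ()

    switch : ∀ {k} → HasComponents E k →
      Σ ℕ λ k′ → HasComponents E′ k′ × k ≤ suc k′ × (S ⟨$⟩ʳ v ≡ v̄ → suc k ≤ k′)
    switch (f , f-onto , f-components) =
      let (k′ , components , lose , gain) = surgery (Alternating.reachable? P′ S v u)
      in k′ , components , lose , λ paired → gain (same-label (old-joined paired)) (new-separated paired)
      where
      open Surgery (Union-sym P′ S) Hub (black v) (black u) old-edge new-edge hub-old hub-new
                   f f-onto f-components

sumFin-+ : ∀ {d} (g h : Fin d → ℕ) → sumFin (λ c → g c + h c) ≡ sumFin g + sumFin h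
sumFin-+ {zero} g h = refl
sumFin-+ {suc d} g h =
  trans (cong (g fzero + h fzero +_) (sumFin-+ (g ∘ fsuc) (h ∘ fsuc)))
        (interchange (g fzero) (h fzero) (sumFin (g ∘ fsuc)) (sumFin (h ∘ fsuc)))

sumFin-mono : ∀ {d} {g h : Fin d → ℕ} → (∀ c → g c ≤ h c) → sumFin g ≤ sumFin h
sumFin-mono {zero} g≤h = z≤n
sumFin-mono {suc d} g≤h = +-mono-≤ (g≤h fzero) (sumFin-mono (g≤h ∘ fsuc))

sumFin-one : ∀ d → sumFin {d} (λ _ → 1) ≡ d
sumFin-one zero = refl
sumFin-one (suc d) = cong suc (sumFin-one d)

χ : ∀ {A : Set} → Dec A → ℕ
χ (yes _) = 1
χ (no _) = 0

length-filter-tabulate : ∀ {d} {A : Set} {Q : A → Set} (Q? : ∀ x → Dec (Q x)) (h : Fin d → A) →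
  length (filter Q? (tabulate h)) ≡ sumFin (λ c → χ (Q? (h c)))
length-filter-tabulate {zero} Q? h = refl
length-filter-tabulate {suc d} Q? h with Q? (h fzero)
... | yes _ = cong suc (length-filter-tabulate Q? (h ∘ fsuc))
... | no _ = length-filter-tabulate Q? (h ∘ fsuc)

colour-balance : ∀ {A : Set} {k k′} (a? : Dec A) → (A → suc k ≤ k′) → k ≤ suc k′ →
  k + (χ a? + χ a?) ≤ k′ + 1
colour-balance {k = k} {k′} (yes a) gain _ =
  subst₂ _≤_ (+-comm 2 k) (+-comm 1 k′) (s≤s (gain a))
colour-balance {k = k} {k′} (no _) _ lose =
  subst₂ _≤_ (sym (+-identityʳ k)) (+-comm 1 k′) lose

lemma3 : ∀ {d n : ℕ} (σ : Colouring d n) → IsConnectedBubble σ →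
    (v v̄ : Fin n) → d < 2 * multiplicity σ v v̄ →
    (π : Permutation′ n) → IsMaxPairing σ π → π ⟨$⟩ʳ v ≡ v̄
lemma3 {d} σ _ v v̄ many π (m , (ks , components , total) , maximal) with π ⟨$⟩ʳ v ≟ v̄
... | yes paired = paired
... | no unpaired = ⊥-elim (<⇒≱ many 2G≤d)
  where
  open Switch π v v̄ unpaired using (P′; switch)
  good : ∀ c → Dec (σ c ⟨$⟩ʳ v ≡ v̄)
  good c = σ c ⟨$⟩ʳ v ≟ v̄
  G : ℕ
  G = sumFin (λ c → χ (good c))
  ks′ : Fin d → ℕ
  ks′ c = proj₁ (switch (σ c) (components c))
  no-better : sumFin ks′ ≤ sumFin ks
  no-better = subst (sumFin ks′ ≤_) (sym total)
    (maximal P′ (sumFin ks′) (ks′ , (λ c → proj₁ (proj₂ (switch (σ c) (components c)))) , refl))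
  balance : sumFin ks + (G + G) ≤ sumFin ks′ + d
  balance = subst₂ _≤_
    (trans (sumFin-+ ks _) (cong (sumFin ks +_) (sumFin-+ (χ ∘ good) (χ ∘ good))))
    (trans (sumFin-+ ks′ _) (cong (sumFin ks′ +_) (sumFin-one d)))
    (sumFin-mono λ c → let (_ , _ , lose , gain) = switch (σ c) (components c)
                       in colour-balance (good c) gain lose)
  2G≤d : 2 * multiplicity σ v v̄ ≤ d
  2G≤d = subst (λ g → 2 * g ≤ d) (sym (length-filter-tabulate good id))
    (subst (_≤ d) (cong (G +_) (sym (+-identityʳ G)))
      (+-cancelˡ-≤ (sumFin ks) _ _ (≤-trans balance (+-monoˡ-≤ d no-better))))
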